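{- For all integers $n\ge 0$ and all complex $x,y,u$, and $q$ with $0<|q|<1$, the polynomials $\mathrm{R}_{n}(x,y;u|q)$ satisfy $$\mathrm{R}_{n+1}(x,y;u|q)=x\,\mathrm{R}_{n}(x,qy;u|q)+y\,\mathrm{R}_{n}(x,uy;u|q),$$ $$\mathrm{R}_{n+1}(x,y;u|q)=x\,\mathrm{R}_{n}(x,y;u|q)+y\,\mathrm{R}_{n}(qx,uy;u|q).$$
   Context: $(a;q)_n=\prod_{k=0}^{n-1}(1-aq^k)$, and the $q$-binomial coefficient is $\genfrac{[}{]}{0pt}{}{n}{k}_{q}=\frac{(q;q)_n}{(q;q)_k(q;q)_{n-k}}$ for $0\le k\le n$. The $u$-deformed homogeneous polynomial is $\mathrm{R}_{n}(x,y;u|q)=\sum_{k=0}^{n}\genfrac{[}{]}{0pt}{}{n}{k}_{q}u^{\binom{k}{2}}x^{n-k}y^{k}$ (with $0^0=1$). -}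

module Defs where

open import Algebra.Bundles using (CommutativeRing)
open import Data.Nat using (ℕ; zero; suc; _∸_)
open import Data.Nat.Combinatorics using (_C_)

-- Definitions over an arbitrary commutative ring R (the identities are
-- polynomial identities; ℂ is not available in agda-stdlib).
module QDefs {c ℓ} (R : CommutativeRing c ℓ) where
  open CommutativeRing R using (Carrier; _+_; _*_; 0#; 1#)

  pow : Carrier → ℕ → Carrier
  pow a zero    = 1#
  pow a (suc n) = a * pow a n

  -- Gaussian (q-)binomial coefficient [n k]_q, via the q-Pascal rule
  -- [n+1, k+1] = [n, k] + q^(k+1) [n, k+1];  [n,0] = 1;  [0,k+1] = 0.
  qbinom : Carrier → ℕ → ℕ → Carrier
  qbinom q n       zero    = 1#
  qbinom q zero    (suc k) = 0#
  qbinom q (suc n) (suc k) = qbinom q n k + pow q (suc k) * qbinom q n (suc k)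

  sumTo : ℕ → (ℕ → Carrier) → Carrier
  sumTo zero    f = f zero
  sumTo (suc n) f = sumTo n f + f (suc n)

  Rpoly : ℕ → Carrier → Carrier → Carrier → Carrier → Carrier
  Rpoly n x y u q =
    sumTo n (λ k → qbinom q n k * pow u (k C 2) * pow x (n ∸ k) * pow y k)

{-# OPTIONS --safe #-}
module Submission where

open import Defs
open import Algebra.Bundles using (CommutativeRing)
open import Data.Nat as ℕ using (ℕ; zero; suc; _∸_; _≤_; _<_; z≤n; s≤s)
open import Data.Nat.Properties using (+-∸-assoc; m≤n⇒m≤1+n; m<n⇒m<1+n; n<1+n; ≤-refl)
open import Data.Nat.Combinatorics using (_C_; nC1≡n; nCk+nC[k+1]≡[n+1]C[k+1])
open import Data.Product using (_×_; _,_)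
open import Relation.Binary.PropositionalEquality as ≡ using (_≡_)

-- The first recurrence is the q-Pascal rule [n+1, k+1] = [n, k] + q^(k+1) [n, k+1]
-- applied termwise: since u^C(k+1,2) = u^k u^C(k,2), the [n, k] part sums to
-- y R_n(x, uy), and the factor q^(k+1) makes the [n, k+1] part sum to x R_n(x, qy).
-- The second recurrence follows by induction on n: expand R_(n+2)(x, y) by the first
-- recurrence, apply the second one for n to both summands, and regroup using the first
-- recurrence again; this works because the dilations y ↦ qy and y ↦ uy commute.

suc-C2 : ∀ k → suc k C 2 ≡ k ℕ.+ k C 2
suc-C2 k = ≡.trans (≡.sym (nCk+nC[k+1]≡[n+1]C[k+1] k 1)) (≡.cong (ℕ._+ k C 2) (nC1≡n k))

module RpolyProperties {c ℓ} (R : CommutativeRing c ℓ) where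
  open CommutativeRing R hiding (zero)
  open QDefs R
  open import Algebra.Properties.CommutativeSemiring.Exp commutativeSemiring
    using (_^_; ^-congˡ; ^-homo-*; ^-distrib-*)
  open import Algebra.Properties.CommutativeSemigroup +-commutativeSemigroup
    using (interchange)
  open import Algebra.Properties.CommutativeSemigroup *-commutativeSemigroup
    using (x∙yz≈y∙xz)
  open import Algebra.Solver.Ring.NaturalCoefficients.Default commutativeSemiring
  open import Relation.Binary.Reasoning.Setoid setoid

  pow≡^ : ∀ a n → pow a n ≡ a ^ n
  pow≡^ a zero    = ≡.refl
  pow≡^ a (suc n) = ≡.cong (a *_) (pow≡^ a n)

  pow-congˡ : ∀ n {a b} → a ≈ b → pow a n ≈ pow b n
  pow-congˡ n {a} {b} a≈b rewrite pow≡^ a n | pow≡^ b n = ^-congˡ n a≈b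

  pow-homo-* : ∀ a m n → pow a (m ℕ.+ n) ≈ pow a m * pow a n
  pow-homo-* a m n rewrite pow≡^ a (m ℕ.+ n) | pow≡^ a m | pow≡^ a n = ^-homo-* a m n

  pow-distrib-* : ∀ a b n → pow (a * b) n ≈ pow a n * pow b n
  pow-distrib-* a b n rewrite pow≡^ (a * b) n | pow≡^ a n | pow≡^ b n = ^-distrib-* a b n

  pow-suc-C2 : ∀ a k → pow a (suc k C 2) ≈ pow a k * pow a (k C 2)
  pow-suc-C2 a k rewrite suc-C2 k = pow-homo-* a k (k C 2)

  pow-suc-∸ : ∀ a {k n} → k ≤ n → pow a (suc n ∸ k) ≈ a * pow a (n ∸ k)
  pow-suc-∸ a k≤n rewrite +-∸-assoc 1 k≤n = refl

  sumTo-cong : ∀ n {f g : ℕ → Carrier} → (∀ k → k ≤ n → f k ≈ g k) → sumTo n f ≈ sumTo n g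
  sumTo-cong zero    f≈g = f≈g 0 z≤n
  sumTo-cong (suc n) f≈g =
    +-cong (sumTo-cong n (λ k k≤n → f≈g k (m≤n⇒m≤1+n k≤n))) (f≈g (suc n) ≤-refl)

  sumTo-distrib-+ : ∀ n (f g : ℕ → Carrier) →
    sumTo n (λ k → f k + g k) ≈ sumTo n f + sumTo n g
  sumTo-distrib-+ zero    f g = refl
  sumTo-distrib-+ (suc n) f g = trans (+-congʳ (sumTo-distrib-+ n f g)) (interchange _ _ _ _)

  sumTo-distribˡ-* : ∀ n a (f : ℕ → Carrier) → sumTo n (λ k → a * f k) ≈ a * sumTo n f
  sumTo-distribˡ-* zero    a f = refl
  sumTo-distribˡ-* (suc n) a f = trans (+-congʳ (sumTo-distribˡ-* n a f)) (sym (distribˡ _ _ _))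

  sumTo-suc-head : ∀ n (f : ℕ → Carrier) → sumTo (suc n) f ≈ f 0 + sumTo n (λ k → f (suc k))
  sumTo-suc-head zero    f = refl
  sumTo-suc-head (suc n) f = trans (+-congʳ (sumTo-suc-head n f)) (+-assoc _ _ _)

  sumTo-pascal : ∀ n {f g h : ℕ → Carrier} → f 0 ≈ g 0 → (∀ k → f (suc k) ≈ h k + g (suc k)) →
    sumTo (suc n) f ≈ sumTo (suc n) g + sumTo n h
  sumTo-pascal n {f} {g} {h} f0≈g0 f-suc≈ = begin
    sumTo (suc n) f                                    ≈⟨ sumTo-suc-head n f ⟩
    f 0 + sumTo n (λ k → f (suc k))                    ≈⟨ +-cong f0≈g0 (sumTo-cong n (λ k _ → f-suc≈ k)) ⟩
    g 0 + sumTo n (λ k → h k + g (suc k))              ≈⟨ +-congˡ (sumTo-distrib-+ n h _) ⟩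
    g 0 + (sumTo n h + sumTo n (λ k → g (suc k)))      ≈⟨ +-congˡ (+-comm _ _) ⟩
    g 0 + (sumTo n (λ k → g (suc k)) + sumTo n h)      ≈⟨ sym (+-assoc _ _ _) ⟩
    (g 0 + sumTo n (λ k → g (suc k))) + sumTo n h      ≈⟨ +-congʳ (sym (sumTo-suc-head n g)) ⟩
    sumTo (suc n) g + sumTo n h                        ∎

  qbinom-vanish : ∀ q {n k} → n < k → qbinom q n k ≈ 0#
  qbinom-vanish q {zero}  {suc k} _           = refl
  qbinom-vanish q {suc n} {suc k} (s≤s n<k) = begin
    qbinom q n k + pow q (suc k) * qbinom q n (suc k) ≈⟨ +-cong (qbinom-vanish q n<k)
                                                                 (*-congˡ (qbinom-vanish q (m<n⇒m<1+n n<k))) ⟩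
    0# + pow q (suc k) * 0#                            ≈⟨ trans (+-identityˡ _) (zeroʳ _) ⟩
    0#                                                 ∎

  module _ (u q : Carrier) where

    -- The exponent of x is decoupled from n: since suc m ∸ suc k reduces to m ∸ k,
    -- the index shift in term-pascal is then definitional.
    term : ℕ → ℕ → Carrier → Carrier → ℕ → Carrier
    term n m x y k = qbinom q n k * pow u (k C 2) * pow x (m ∸ k) * pow y k

    term-vanish : ∀ {n k} m x y → n < k → term n m x y k ≈ 0#
    term-vanish {n} {k} m x y n<k = begin
      qbinom q n k * U * X * Y ≈⟨ *-congʳ (*-congʳ (*-congʳ (qbinom-vanish q n<k))) ⟩
      0# * U * X * Y           ≈⟨ solve 3 (λ U X Y → con 0 :* U :* X :* Y := con 0) refl U X Y ⟩
      0#                       ∎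
      where U = pow u (k C 2); X = pow x (m ∸ k); Y = pow y k

    term-raise : ∀ n {m k} x y → k ≤ m → term n (suc m) x y k ≈ x * term n m x y k
    term-raise n {m} {k} x y k≤m = begin
      B * U * pow x (suc m ∸ k) * Y ≈⟨ *-congʳ (*-congˡ (pow-suc-∸ x k≤m)) ⟩
      B * U * (x * X) * Y           ≈⟨ solve 5 (λ B U X Y x → B :* U :* (x :* X) :* Y := x :* (B :* U :* X :* Y))
                                              refl B U X Y x ⟩
      x * (B * U * X * Y)           ∎
      where B = qbinom q n k; U = pow u (k C 2); X = pow x (m ∸ k); Y = pow y k

    term-pascal : ∀ n x y k →
      term (suc n) (suc n) x y (suc k) ≈ y * term n n x (u * y) k + term n (suc n) x (q * y) (suc k)
    term-pascal n x y k = begin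
      (B₀ + q * Qᵏ * B₁) * pow u (suc k C 2) * X * (y * Y)
        ≈⟨ *-congʳ (*-congʳ (*-congˡ (pow-suc-C2 u k))) ⟩
      (B₀ + q * Qᵏ * B₁) * (Uᵏ * U) * X * (y * Y)
        ≈⟨ solve 9 (λ B₀ B₁ q Qᵏ U Uᵏ X y Y →
                      (B₀ :+ q :* Qᵏ :* B₁) :* (Uᵏ :* U) :* X :* (y :* Y)
                   := y :* (B₀ :* U :* X :* (Uᵏ :* Y)) :+ B₁ :* (Uᵏ :* U) :* X :* (q :* y :* (Qᵏ :* Y)))
                 refl B₀ B₁ q Qᵏ U Uᵏ X y Y ⟩
      y * (B₀ * U * X * (Uᵏ * Y)) + B₁ * (Uᵏ * U) * X * (q * y * (Qᵏ * Y))
        ≈⟨ +-cong (*-congˡ (*-congˡ (sym (pow-distrib-* u y k))))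
                  (*-cong (*-congʳ (*-congˡ (sym (pow-suc-C2 u k)))) (*-congˡ (sym (pow-distrib-* q y k)))) ⟩
      y * (B₀ * U * X * pow (u * y) k) + B₁ * pow u (suc k C 2) * X * pow (q * y) (suc k)
        ∎
      where B₀ = qbinom q n k; B₁ = qbinom q n (suc k); Qᵏ = pow q k
            U = pow u (k C 2); Uᵏ = pow u k; X = pow x (n ∸ k); Y = pow y k

    Rpoly-congʸ : ∀ n x {y y′} → y ≈ y′ → Rpoly n x y u q ≈ Rpoly n x y′ u q
    Rpoly-congʸ n x y≈y′ = sumTo-cong n (λ k _ → *-congˡ (pow-congˡ k y≈y′))

    Rpoly-suc-qy-uy : ∀ n x y →
      Rpoly (suc n) x y u q ≈ x * Rpoly n x (q * y) u q + y * Rpoly n x (u * y) u q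
    Rpoly-suc-qy-uy n x y = begin
      sumTo (suc n) (term (suc n) (suc n) x y)
        ≈⟨ sumTo-pascal n refl (term-pascal n x y) ⟩
      sumTo (suc n) (term n (suc n) x (q * y)) + sumTo n (λ k → y * term n n x (u * y) k)
        ≈⟨ +-cong (trans (+-congˡ (term-vanish (suc n) x (q * y) (n<1+n n))) (+-identityʳ _))
                  (sumTo-distribˡ-* n y _) ⟩
      sumTo n (term n (suc n) x (q * y)) + y * Rpoly n x (u * y) u q
        ≈⟨ +-congʳ (trans (sumTo-cong n (λ k → term-raise n x (q * y))) (sumTo-distribˡ-* n x _)) ⟩
      x * Rpoly n x (q * y) u q + y * Rpoly n x (u * y) u q
        ∎

    Rpoly-suc-qx-uy : ∀ n x y →
      Rpoly (suc n) x y u q ≈ x * Rpoly n x y u q + y * Rpoly n (q * x) (u * y) u q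
    Rpoly-suc-qx-uy zero    x y = Rpoly-suc-qy-uy zero x y   -- R_0 is constantly 1
    Rpoly-suc-qx-uy (suc n) x y = begin
      Rpoly (suc (suc n)) x y u q
        ≈⟨ Rpoly-suc-qy-uy (suc n) x y ⟩
      x * Rpoly (suc n) x (q * y) u q + y * Rpoly (suc n) x (u * y) u q
        ≈⟨ +-cong (*-congˡ (Rpoly-suc-qx-uy n x (q * y))) (*-congˡ (Rpoly-suc-qx-uy n x (u * y))) ⟩
      x * (x * A₁ + q * y * Rpoly n (q * x) (u * (q * y)) u q) + y * (x * A₂ + u * y * A₄)
        ≈⟨ +-congʳ (*-congˡ (+-congˡ (*-congˡ (Rpoly-congʸ n (q * x) (x∙yz≈y∙xz u q y))))) ⟩
      x * (x * A₁ + q * y * A₃) + y * (x * A₂ + u * y * A₄)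
        ≈⟨ solve 8 (λ x y q u A₁ A₂ A₃ A₄ →
                      x :* (x :* A₁ :+ q :* y :* A₃) :+ y :* (x :* A₂ :+ u :* y :* A₄)
                   := x :* (x :* A₁ :+ y :* A₂) :+ y :* (q :* x :* A₃ :+ u :* y :* A₄))
                 refl x y q u A₁ A₂ A₃ A₄ ⟩
      x * (x * A₁ + y * A₂) + y * (q * x * A₃ + u * y * A₄)
        ≈⟨ sym (+-cong (*-congˡ (Rpoly-suc-qy-uy n x y)) (*-congˡ (Rpoly-suc-qy-uy n (q * x) (u * y)))) ⟩
      x * Rpoly (suc n) x y u q + y * Rpoly (suc n) (q * x) (u * y) u q
        ∎
      where
      A₁ = Rpoly n x (q * y) u q
      A₂ = Rpoly n x (u * y) u q
      A₃ = Rpoly n (q * x) (q * (u * y)) u q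
      A₄ = Rpoly n (q * x) (u * (u * y)) u q

mainTheorem2 : ∀ {c ℓ} (R : CommutativeRing c ℓ) →
    let open CommutativeRing R
        open QDefs R
    in ∀ (n : ℕ) (x y u q : Carrier) →
      (Rpoly (suc n) x y u q ≈ x * Rpoly n x (q * y) u q + y * Rpoly n x (u * y) u q)
      × (Rpoly (suc n) x y u q ≈ x * Rpoly n x y u q + y * Rpoly n (q * x) (u * y) u q)
mainTheorem2 R n x y u q = Rpoly-suc-qy-uy u q n x y , Rpoly-suc-qx-uy u q n x y
  where open RpolyProperties R
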